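{- Let $p \in \{2,3,5\}$ and $n \geq 2$ with $p^n > 5$, and put $n_p = p$ if $p \in \{3,5\}$ and $n_2 = 4$. Let $A$ be a cyclic permutation group of order $p^n$ on a finite set such that $A$ has exactly two nontrivial orbits (orbits of size at least $2$), one of cardinality $p^n$ and the other of cardinality $n_p$ (any number of fixed points is allowed). Then $A \in GR^*(3)$.
   Context: A cyclic permutation group is a permutation group generated by a single permutation; its order is the number of its elements. A $k$-colored graph $G=(V,E)$ consists of a finite set $V$ and a function $E$ from the 2-element subsets of $V$ to $\{0,\ldots,k-1\}$. An automorphism of $G$ is a permutation of $V$ preserving $E$; $Aut(G)$ is the automorphism group as a permutation group on $V$. $GR(k)$ is the class of permutation groups $(A,V)$ with $A=Aut(G)$ for some $k$-colored graph $G$ on $V$; $GR^*(k)=GR(k)\setminus GR(k-1)$. -}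

module Defs where

open import Data.Nat using (ℕ; zero; suc; _^_; _≥_; _>_)
open import Data.Fin using (Fin)
open import Data.Fin.Permutation using (Permutation′; _⟨$⟩ʳ_)
open import Data.Product using (Σ; ∃; _×_)
open import Data.Sum using (_⊎_)
open import Relation.Binary.PropositionalEquality using (_≡_; _≢_)
open import Relation.Nullary using (¬_)
open import Function.Bundles using (_⇔_)

pow : ∀ {m} → Permutation′ m → ℕ → Fin m → Fin m
pow σ zero    x = x
pow σ (suc i) x = σ ⟨$⟩ʳ (pow σ i x)

_≈ₚ_ : ∀ {m} → Permutation′ m → Permutation′ m → Set
π ≈ₚ ρ = ∀ x → π ⟨$⟩ʳ x ≡ ρ ⟨$⟩ʳ x

InCyclic : ∀ {m} → Permutation′ m → Permutation′ m → Set
InCyclic σ π = ∃ λ i → ∀ x → π ⟨$⟩ʳ x ≡ pow σ i x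

CyclicOrder : ∀ {m} → Permutation′ m → ℕ → Set
CyclicOrder {m} σ N =
  Σ (Fin N → Permutation′ m) λ f →
    (∀ i j → f i ≈ₚ f j → i ≡ j) ×
    (∀ i → InCyclic σ (f i)) ×
    (∀ π → InCyclic σ π → ∃ λ i → f i ≈ₚ π)

InOrbit : ∀ {m} → Permutation′ m → Fin m → Fin m → Set
InOrbit σ x y = ∃ λ i → pow σ i x ≡ y

OrbitCard : ∀ {m} → Permutation′ m → Fin m → ℕ → Set
OrbitCard {m} σ x c =
  Σ (Fin c → Fin m) λ f →
    (∀ i j → f i ≡ f j → i ≡ j) ×
    (∀ i → InOrbit σ x (f i)) ×
    (∀ y → InOrbit σ x y → ∃ λ i → f i ≡ y)

-- a k-colored (complete) graph on Fin m: a colouring of the 2-element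
-- subsets, represented as a symmetric function (diagonal values irrelevant)
record ColoredGraph (k m : ℕ) : Set where
  field
    col  : Fin m → Fin m → Fin k
    symm : ∀ x y → col x y ≡ col y x
open ColoredGraph public

IsAut : ∀ {k m} → ColoredGraph k m → Permutation′ m → Set
IsAut G π = ∀ x y → x ≢ y → col G (π ⟨$⟩ʳ x) (π ⟨$⟩ʳ y) ≡ col G x y

CyclicInGR : ℕ → ∀ {m} → Permutation′ m → Set
CyclicInGR k {m} σ =
  ∃ λ (G : ColoredGraph k m) → ∀ π → InCyclic σ π ⇔ IsAut G π

CyclicInGR* : ℕ → ∀ {m} → Permutation′ m → Set
CyclicInGR* zero    σ = CyclicInGR zero σ
CyclicInGR* (suc k) σ = CyclicInGR (suc k) σ × ¬ CyclicInGR k σ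

-- n_p : n_2 = 4, n_3 = 3, n_5 = 5 (other values irrelevant)
np : ℕ → ℕ
np 2 = 4
np p = p

module Submission where

-- After general facts on iterates and orbits of a permutation (Iterates) and
-- on automorphisms of coloured graphs, two arguments follow.
--  • GR(3): the graph G₃ matches σⁱ x₁ with σⁱ x₂ in colour 2 and carries in
--    colour 1 the cycle O₁, the edges σⁱ x₁ — σⁱ⁺¹ x₂, a path through the
--    free points, and edges from the least free point to O₁.  Colour-2
--    degrees separate O₁, O₂ and the free points; an automorphism fixing x₁
--    then fixes σ x₁ (the edge σ⁻¹ x₁ — x₂ orients O₁), hence all of O₁, O₂
--    and, inductively along the path, every free point.
--  • not GR(2): any 2-colouring of ℤ/q, q ∈ {3, 4, 5}, is mirror symmetric
--    (a finite check); reflecting O₁ about x₁ and O₂ about the mirror centre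
--    of the colours seen by x₁ is then an automorphism outside ⟨σ⟩.

open import Defs
open import Data.Nat using (ℕ; zero; suc; _+_; _*_; _∸_; _^_; _≤_; _<_; _≥_; _>_; z≤n; s≤s; s≤s⁻¹; NonZero; >-nonZero; >-nonZero⁻¹)
open import Data.Nat.Properties
open import Data.Nat.Divisibility using (_∣_; m∣m*n)
open import Data.Nat.DivMod using (_%_; _/_; m≡m%n+[m/n]*n; m%n<n)
open import Data.Bool using (Bool; true; false)
open import Data.Bool.Properties using () renaming (_≟_ to _≟ᵇ_)
open import Data.Fin using (Fin; toℕ; fromℕ<) renaming (zero to fzero; suc to fsuc; _<_ to _<ᶠ_)
open import Data.Fin.Properties using (nonZeroIndex; toℕ-fromℕ<; toℕ<n; toℕ-injective; pigeonhole; injective⇒≤; all?; any?)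
  renaming (_≟_ to _≟ᶠ_; _<?_ to _<ᶠ?_)
open import Data.Fin.Subset using (Subset)
open import Data.Fin.Subset.Properties using (anySubset?)
open import Data.Fin.Permutation using (Permutation′; _⟨$⟩ʳ_; _⟨$⟩ˡ_; inverseˡ; inverseʳ; _∘ₚ_; permutation; flip)
  renaming (id to idₚ)
open import Data.Vec using (lookup; tabulate)
open import Data.Vec.Properties using (lookup∘tabulate)
open import Data.Product using (Σ; ∃; _×_; _,_; proj₁; proj₂)
open import Data.Sum using (_⊎_; inj₁; inj₂; swap) renaming (map to map⊎)
open import Data.Empty using (⊥; ⊥-elim)
open import Function using (_∘_)
open import Function.Bundles using (mk⇔; Equivalence)
open import Relation.Nullary using (¬_; Dec; yes; no; does)
open import Relation.Nullary.Decidable using (¬?; _×-dec_; _⊎-dec_; _→-dec_; does-⇔; dec-false; from-no; decidable-stable)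
open import Relation.Binary.Definitions using (tri<; tri≈; tri>)
open import Relation.Binary.PropositionalEquality using (_≡_; _≢_; refl; sym; trans; cong; cong₂; subst; subst₂; module ≡-Reasoning)

permutation-injective : ∀ {m} (π : Permutation′ m) {x y} → π ⟨$⟩ʳ x ≡ π ⟨$⟩ʳ y → x ≡ y
permutation-injective π {x} {y} e = trans (sym (inverseˡ π)) (trans (cong (π ⟨$⟩ˡ_) e) (inverseˡ π))

module Iterates {m : ℕ} (σ : Permutation′ m) where

  S : Fin m → Fin m
  S x = σ ⟨$⟩ʳ x

  P : ℕ → Fin m → Fin m
  P = pow σ

  pow-+ : ∀ a b x → P (a + b) x ≡ P a (P b x)
  pow-+ zero    b x = refl
  pow-+ (suc a) b x = cong S (pow-+ a b x)

  pow-comm : ∀ a b x → P a (P b x) ≡ P b (P a x)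
  pow-comm a b x = begin
    P a (P b x)  ≡⟨ pow-+ a b x ⟨
    P (a + b) x  ≡⟨ cong (λ k → P k x) (+-comm a b) ⟩
    P (b + a) x  ≡⟨ pow-+ b a x ⟩
    P b (P a x)  ∎
    where open ≡-Reasoning

  S-injective : ∀ {x y} → S x ≡ S y → x ≡ y
  S-injective = permutation-injective σ

  pow-injective : ∀ a {x y} → P a x ≡ P a y → x ≡ y
  pow-injective zero    e = e
  pow-injective (suc a) e = pow-injective a (S-injective e)

  pow-multiple : ∀ {d y} → P d y ≡ y → ∀ k → P (k * d) y ≡ y
  pow-multiple e zero = refl
  pow-multiple {d} {y} e (suc k) =
    trans (pow-+ d (k * d) y) (trans (cong (P d) (pow-multiple e k)) e)

  pow-mod : ∀ {d y} .{{_ : NonZero d}} → P d y ≡ y → ∀ i → P i y ≡ P (i % d) y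
  pow-mod {d} {y} e i = trans (cong (λ k → P k y) (m≡m%n+[m/n]*n i d))
    (trans (pow-+ (i % d) ((i / d) * d) y) (cong (P (i % d)) (pow-multiple e (i / d))))

  period-from-collision : ∀ i j b → i ≤ j → P i b ≡ P j b → P (j ∸ i) b ≡ b
  period-from-collision i j b i≤j e = sym (pow-injective i (begin
    P i b                ≡⟨ e ⟩
    P j b                ≡⟨ cong (λ k → P k b) (m∸n+n≡m i≤j) ⟨
    P (j ∸ i + i) b      ≡⟨ pow-+ (j ∸ i) i b ⟩
    P (j ∸ i) (P i b)    ≡⟨ pow-comm (j ∸ i) i b ⟩
    P i (P (j ∸ i) b)    ∎))
    where open ≡-Reasoning

  powₚ : ℕ → Permutation′ m
  powₚ zero    = idₚ
  powₚ (suc k) = powₚ k ∘ₚ σ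

  powₚ-apply : ∀ k x → powₚ k ⟨$⟩ʳ x ≡ P k x
  powₚ-apply zero    x = refl
  powₚ-apply (suc k) x = cong S (powₚ-apply k x)

  module Orbit (b : Fin m) (c : ℕ) (card : OrbitCard σ b c) where

    private
      enum : Fin c → Fin m
      enum = proj₁ card
      enum-injective : ∀ i j → enum i ≡ enum j → i ≡ j
      enum-injective = proj₁ (proj₂ card)
      enum-inOrbit : ∀ i → InOrbit σ b (enum i)
      enum-inOrbit = proj₁ (proj₂ (proj₂ card))
      enum-onto : ∀ y → InOrbit σ b y → ∃ λ i → enum i ≡ y
      enum-onto = proj₂ (proj₂ (proj₂ card))

      index : ℕ → Fin c
      index i = proj₁ (enum-onto (P i b) (i , refl))

      index-correct : ∀ i → enum (index i) ≡ P i b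
      index-correct i = proj₂ (enum-onto (P i b) (i , refl))

    instance
      nonZero : NonZero c
      nonZero = nonZeroIndex (index 0)

    positive : c > 0
    positive = >-nonZero⁻¹ c

    -- every positive period d of b satisfies c ≤ d: reducing exponents
    -- modulo d maps the c distinct points of the orbit injectively into Fin d
    minimal : ∀ d .{{_ : NonZero d}} → P d b ≡ b → c ≤ d
    minimal d e = injective⇒≤ {f = residue} residue-injective
      where
      exponent : Fin c → ℕ
      exponent i = proj₁ (enum-inOrbit i)
      residue : Fin c → Fin d
      residue i = fromℕ< (m%n<n (exponent i) d)
      point : ∀ i → P (toℕ (residue i)) b ≡ enum i
      point i = begin
        P (toℕ (residue i)) b  ≡⟨ cong (λ k → P k b) (toℕ-fromℕ< (m%n<n (exponent i) d)) ⟩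
        P (exponent i % d) b   ≡⟨ pow-mod e (exponent i) ⟨
        P (exponent i) b       ≡⟨ proj₂ (enum-inOrbit i) ⟩
        enum i                 ∎
        where open ≡-Reasoning
      residue-injective : ∀ {i j} → residue i ≡ residue j → i ≡ j
      residue-injective {i} {j} r =
        enum-injective i j (trans (sym (point i)) (trans (cong (λ k → P (toℕ k) b) r) (point j)))

    -- c is a period of b: among the c + 1 points b, σ b, …, σ^c b two coincide
    period : P c b ≡ b
    period with pigeonhole (n<1+n c) (λ (i : Fin (suc c)) → index (toℕ i))
    ... | i , j , i<j , same = subst (λ k → P k b ≡ b) gap≡c gap-period
      where
      gap-period : P (toℕ j ∸ toℕ i) b ≡ b
      gap-period = period-from-collision (toℕ i) (toℕ j) b (<⇒≤ i<j)
        (trans (sym (index-correct (toℕ i))) (trans (cong enum same) (index-correct (toℕ j))))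
      gap≡c : toℕ j ∸ toℕ i ≡ c
      gap≡c = ≤-antisym (≤-trans (m∸n≤m (toℕ j) (toℕ i)) (s≤s⁻¹ (toℕ<n j)))
                        (minimal _ {{>-nonZero (m<n⇒0<n∸m i<j)}} gap-period)

    no-smaller-period : ∀ d → 0 < d → d < c → P d b ≢ b
    no-smaller-period d 0<d d<c e = <⇒≱ d<c (minimal d {{>-nonZero 0<d}} e)

    exponent-injective : ∀ {i j} → i < c → j < c → P i b ≡ P j b → i ≡ j
    exponent-injective {i} {j} i<c j<c e with <-cmp i j
    ... | tri≈ _ i≡j _ = i≡j
    ... | tri< i<j _ _ = ⊥-elim (no-smaller-period (j ∸ i) (m<n⇒0<n∸m i<j)
            (≤-<-trans (m∸n≤m j i) j<c) (period-from-collision i j b (<⇒≤ i<j) e))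
    ... | tri> _ _ j<i = ⊥-elim (no-smaller-period (i ∸ j) (m<n⇒0<n∸m j<i)
            (≤-<-trans (m∸n≤m i j) i<c) (period-from-collision j i b (<⇒≤ j<i) (sym e)))

    member? : ∀ y → (Σ ℕ λ i → i < c × P i b ≡ y) ⊎ ¬ InOrbit σ b y
    member? y with anyUpTo? (λ i → P i b ≟ᶠ y) c
    ... | yes found = inj₁ found
    ... | no none   = inj₂ λ { (i , e) → none (i % c , m%n<n i c , trans (sym (pow-mod period i)) e) }

    -- The reflection σⁱ b ↦ σ^(a − i) b of the orbit about its point σᵃ b,
    -- extended by the identity outside the orbit.
    module Reflection (a : ℕ) where

      reflect : Fin m → Fin m
      reflect y with member? y
      ... | inj₁ (i , _ , _) = P (c ∸ i) (P a b)
      ... | inj₂ _           = y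

      reflect-spec : ∀ {k y} → P k b ≡ y → P k (reflect y) ≡ P a b
      reflect-spec {k} {y} e with member? y
      ... | inj₂ ∉orbit = ⊥-elim (∉orbit (k , e))
      ... | inj₁ (i , i<c , eᵢ) = begin
        P k (P (c ∸ i) (P a b))   ≡⟨ pow-comm k (c ∸ i) (P a b) ⟩
        P (c ∸ i) (P k (P a b))   ≡⟨ cong (P (c ∸ i)) (pow-comm k a b) ⟩
        P (c ∸ i) (P a (P k b))   ≡⟨ cong (P (c ∸ i) ∘ P a) (trans e (sym eᵢ)) ⟩
        P (c ∸ i) (P a (P i b))   ≡⟨ cong (P (c ∸ i)) (pow-comm a i b) ⟩
        P (c ∸ i) (P i (P a b))   ≡⟨ pow-+ (c ∸ i) i (P a b) ⟨
        P (c ∸ i + i) (P a b)     ≡⟨ cong (λ t → P t (P a b)) (m∸n+n≡m (<⇒≤ i<c)) ⟩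
        P c (P a b)               ≡⟨ pow-comm c a b ⟩
        P a (P c b)               ≡⟨ cong (P a) period ⟩
        P a b                     ∎
        where open ≡-Reasoning

      reflect-InOrbit : ∀ {y} → InOrbit σ b y → InOrbit σ b (reflect y)
      reflect-InOrbit {y} o with member? y
      ... | inj₁ (i , _ , _) = c ∸ i + a , pow-+ (c ∸ i) a b
      ... | inj₂ ∉orbit      = ⊥-elim (∉orbit o)

      reflect-outside : ∀ {y} → ¬ InOrbit σ b y → reflect y ≡ y
      reflect-outside {y} ∉orbit with member? y
      ... | inj₁ (i , _ , e) = ⊥-elim (∉orbit (i , e))
      ... | inj₂ _           = refl

      reflect-involutive : ∀ {y} → InOrbit σ b y → reflect (reflect y) ≡ y
      reflect-involutive {y} (k , e) with reflect-InOrbit (k , e)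
      ... | k′ , e′ = pow-injective k′ (trans (reflect-spec {k′} e′) (sym (begin
        P k′ y                ≡⟨ cong (P k′) e ⟨
        P k′ (P k b)          ≡⟨ pow-comm k′ k b ⟩
        P k (P k′ b)          ≡⟨ cong (P k) e′ ⟩
        P k (reflect y)       ≡⟨ reflect-spec {k} e ⟩
        P a b                 ∎)))
        where open ≡-Reasoning

      reflect-pair : ∀ i j {y z} → P i b ≡ y → P j b ≡ z →
                     P (i + j) (reflect y) ≡ P a z × P (i + j) (reflect z) ≡ P a y
      reflect-pair i j {y} {z} eᵢ eⱼ =
        swapped i j eᵢ eⱼ , trans (cong (λ t → P t (reflect z)) (+-comm i j)) (swapped j i eⱼ eᵢ)
        where
        open ≡-Reasoning
        swapped : ∀ i j {y z} → P i b ≡ y → P j b ≡ z → P (i + j) (reflect y) ≡ P a z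
        swapped i j {y} {z} eᵢ eⱼ = begin
          P (i + j) (reflect y)     ≡⟨ cong (λ t → P t (reflect y)) (+-comm i j) ⟩
          P (j + i) (reflect y)     ≡⟨ pow-+ j i (reflect y) ⟩
          P j (P i (reflect y))     ≡⟨ cong (P j) (reflect-spec {i} eᵢ) ⟩
          P j (P a b)               ≡⟨ pow-comm j a b ⟩
          P a (P j b)               ≡⟨ cong (P a) eⱼ ⟩
          P a z                     ∎

      reflect-reverses : ∀ {w} k → InOrbit σ b w → P k (reflect (P k w)) ≡ reflect w
      reflect-reverses {w} k (l , e) = pow-injective l (begin
        P l (P k (reflect (P k w)))   ≡⟨ pow-+ l k _ ⟨
        P (l + k) (reflect (P k w))   ≡⟨ cong (λ t → P t (reflect (P k w))) (+-comm l k) ⟩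
        P (k + l) (reflect (P k w))   ≡⟨ reflect-spec {k + l} (trans (pow-+ k l b) (cong (P k) e)) ⟩
        P a b                         ≡⟨ reflect-spec {l} e ⟨
        P l (reflect w)               ∎)
        where open ≡-Reasoning

pow-preserves : ∀ {k m} (G : ColoredGraph k m) (σ : Permutation′ m) → IsAut G σ →
  ∀ i x y → x ≢ y → col G (pow σ i x) (pow σ i y) ≡ col G x y
pow-preserves G σ aut zero    x y x≢y = refl
pow-preserves G σ aut (suc i) x y x≢y =
  trans (aut (pow σ i x) (pow σ i y) (λ e → x≢y (Iterates.pow-injective σ i e)))
        (pow-preserves G σ aut i x y x≢y)

-- Automorphisms are closed under composition ((π ∘ₚ ρ) x = ρ (π x)).
∘-automorphism : ∀ {k m} (G : ColoredGraph k m) (π ρ : Permutation′ m) → IsAut G π → IsAut G ρ → IsAut G (π ∘ₚ ρ)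
∘-automorphism G π ρ aut-π aut-ρ x y x≢y =
  trans (aut-ρ (π ⟨$⟩ʳ x) (π ⟨$⟩ʳ y) (x≢y ∘ permutation-injective π))
        (aut-π x y x≢y)

cyclic-automorphisms : ∀ {k m} (G : ColoredGraph k m) (σ : Permutation′ m) → IsAut G σ →
  ∀ π → InCyclic σ π → IsAut G π
cyclic-automorphisms G σ aut π (i , π≈σⁱ) x y x≢y =
  trans (cong₂ (col G) (π≈σⁱ x) (π≈σⁱ y)) (pow-preserves G σ aut i x y x≢y)

greatest-below : ∀ {m} {Q : Fin m → Set} → (∀ v → Dec (Q v)) → ∀ b → (∃ λ v → toℕ v < b × Q v) →
  Σ (Fin m) λ w → toℕ w < b × Q w × (∀ v → w <ᶠ v → toℕ v < b → ¬ Q v)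
greatest-below Q? zero    (_ , () , _)
greatest-below Q? (suc b) (v₀ , v₀<1+b , q₀) with any? (λ v → (toℕ v ≟ b) ×-dec Q? v)
... | yes (v , v≡b , qᵥ) = v , s≤s (≤-reflexive v≡b) , qᵥ ,
      λ v′ v<v′ v′<1+b _ → <-irrefl refl (≤-trans (subst (λ t → suc t ≤ toℕ v′) v≡b v<v′) (s≤s⁻¹ v′<1+b))
... | no ¬at-b with greatest-below Q? b (v₀ , ≤∧≢⇒< (s≤s⁻¹ v₀<1+b) (λ e → ¬at-b (v₀ , e , q₀)) , q₀)
...   | w , w<b , q-w , above = w , m<n⇒m<1+n w<b , q-w ,
      λ v w<v v<1+b qᵥ → above v w<v (≤∧≢⇒< (s≤s⁻¹ v<1+b) (λ e → ¬at-b (v , e , qᵥ))) qᵥ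

transport-does : ∀ {A B : Set} (a? : Dec A) (b? : Dec B) → does a? ≡ does b? → A → B
transport-does (yes _) (yes b) _  _ = b
transport-does (yes _) (no _)  () _
transport-does (no ¬a) _       _  a = ⊥-elim (¬a a)

-- A function h on ℕ, viewed as a colouring of the cycle ℤ/q, is mirror
-- symmetric: some reflection k ↦ c − k of ℤ/q preserves it.
Mirrored : ∀ {A : Set} → ℕ → (ℕ → A) → Set
Mirrored q h = ∃ λ c → ∀ {k} → k < q → h (c + q ∸ k) ≡ h k

-- the same with the centre bounded, which makes it decidable
MirroredBelow : ∀ {A : Set} → ℕ → (ℕ → A) → Set
MirroredBelow q h = ∃ λ c → c < q × ∀ {k} → k < q → h (c + q ∸ k) ≡ h k

bitAt : ∀ {q} .{{_ : NonZero q}} → Subset q → ℕ → Bool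
bitAt {q} v t = lookup v (fromℕ< (m%n<n t q))

mirrored? : ∀ q .{{_ : NonZero q}} (v : Subset q) → Dec (MirroredBelow q (bitAt v))
mirrored? q v = anyUpTo? (λ c → allUpTo? (λ k → bitAt v (c + q ∸ k) ≟ᵇ bitAt v k) q) q

-- For q ∈ {3, 4, 5} every 2-colouring of the q-cycle is mirror symmetric
-- (for q = 6 the colouring 110100 is not): a search over all 2^q colourings
-- finds no counterexample.
small-cycles-mirrored : ∀ q → q ≡ 3 ⊎ q ≡ 4 ⊎ q ≡ 5 → .{{_ : NonZero q}} →
  (v : Subset q) → Mirrored q (bitAt v)
small-cycles-mirrored q q∈345 v with decidable-stable (mirrored? q v) (λ ¬m → no-counterexample q∈345 (v , ¬m))
  where
  no-counterexample : ∀ {q} → q ≡ 3 ⊎ q ≡ 4 ⊎ q ≡ 5 → .{{_ : NonZero q}} →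
    ¬ ∃ λ (v : Subset q) → ¬ MirroredBelow q (bitAt v)
  no-counterexample (inj₁ refl)        = from-no (anySubset? (λ v → ¬? (mirrored? 3 v)))
  no-counterexample (inj₂ (inj₁ refl)) = from-no (anySubset? (λ v → ¬? (mirrored? 4 v)))
  no-counterexample (inj₂ (inj₂ refl)) = from-no (anySubset? (λ v → ¬? (mirrored? 5 v)))
... | c , _ , mirror = c , mirror

isZero : Fin 2 → Bool
isZero fzero    = true
isZero (fsuc _) = false

isZero-injective : ∀ {a b} → isZero a ≡ isZero b → a ≡ b
isZero-injective {fzero}       {fzero}       _ = refl
isZero-injective {fsuc fzero}  {fsuc fzero}  _ = refl
isZero-injective {fzero}       {fsuc fzero}  ()
isZero-injective {fsuc fzero}  {fzero}       ()

periodic-mirrored : ∀ q → q ≡ 3 ⊎ q ≡ 4 ⊎ q ≡ 5 → .{{_ : NonZero q}} →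
  (h : ℕ → Fin 2) → (∀ t → h t ≡ h (t % q)) → Mirrored q h
periodic-mirrored q q∈345 h periodic = centre , λ k<q →
  isZero-injective (trans (sym (decode _)) (trans (mirror k<q) (decode _)))
  where
  bits : Subset q
  bits = tabulate (λ i → isZero (h (toℕ i)))
  centre : ℕ
  centre = proj₁ (small-cycles-mirrored q q∈345 bits)
  mirror : ∀ {k} → k < q → bitAt bits (centre + q ∸ k) ≡ bitAt bits k
  mirror = proj₂ (small-cycles-mirrored q q∈345 bits)
  decode : ∀ t → bitAt bits t ≡ isZero (h t)
  decode t = begin
    lookup bits (fromℕ< (m%n<n t q))       ≡⟨ lookup∘tabulate (λ i → isZero (h (toℕ i))) _ ⟩
    isZero (h (toℕ (fromℕ< (m%n<n t q))))  ≡⟨ cong (isZero ∘ h) (toℕ-fromℕ< (m%n<n t q)) ⟩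
    isZero (h (t % q))                      ≡⟨ cong isZero (periodic t) ⟨
    isZero (h t)                            ∎
    where open ≡-Reasoning

module TwoOrbits {m : ℕ} (σ : Permutation′ m) (x₁ x₂ : Fin m) (N q : ℕ)
  (card₁ : OrbitCard σ x₁ N) (card₂ : OrbitCard σ x₂ q)
  (q∣N : q ∣ N) (q<N : q < N) (3≤q : 3 ≤ q)
  (covered : ∀ y → OrbitCard σ y 1 ⊎ InOrbit σ x₁ y ⊎ InOrbit σ x₂ y) where

  open Iterates σ public
  module O₁ = Orbit x₁ N card₁
  module O₂ = Orbit x₂ q card₂

  InO₁ InO₂ Free : Fin m → Set
  InO₁ y = InOrbit σ x₁ y
  InO₂ y = InOrbit σ x₂ y
  Free y = ¬ InO₁ y × ¬ InO₂ y

  O₂-period-N : P N x₂ ≡ x₂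
  O₂-period-N = subst (λ k → P k x₂ ≡ x₂) (sym (_∣_.equality q∣N)) (pow-multiple O₂.period (_∣_.quotient q∣N))

  -- a common point would make q < N a period of x₁
  disjoint : ∀ {y} → InO₁ y → InO₂ y → ⊥
  disjoint {y} (i , eᵢ) (j , eⱼ) = O₁.no-smaller-period q (≤-trans (s≤s z≤n) 3≤q) q<N
    (pow-injective i (begin
      P i (P q x₁)  ≡⟨ pow-comm i q x₁ ⟩
      P q (P i x₁)  ≡⟨ cong (P q) eᵢ ⟩
      P q y         ≡⟨ cong (P q) eⱼ ⟨
      P q (P j x₂)  ≡⟨ pow-comm q j x₂ ⟩
      P j (P q x₂)  ≡⟨ cong (P j) O₂.period ⟩
      P j x₂        ≡⟨ eⱼ ⟩
      y             ≡⟨ eᵢ ⟨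
      P i x₁        ∎))
    where open ≡-Reasoning

  2<N : 2 < N
  2<N = ≤-<-trans (≤-trans (s≤s (s≤s z≤n)) 3≤q) q<N

  1<N : 1 < N
  1<N = <-trans (n<1+n 1) 2<N

  InOrbit-pow : ∀ {b y} k → InOrbit σ b y → InOrbit σ b (P k y)
  InOrbit-pow {b} k (i , e) = k + i , trans (pow-+ k i b) (cong (P k) e)

  -- σ^N = id, so σ^(N−1) inverts σ and orbits are closed under σ⁻¹
  period-N : ∀ y → P N y ≡ y
  period-N y with covered y
  ... | inj₁ fixed = trans (cong (λ k → P k y) (sym (*-identityʳ N))) (pow-multiple (Orbit.period y 1 fixed) N)
  ... | inj₂ (inj₁ (i , e)) = trans (cong (P N) (sym e)) (trans (pow-comm N i x₁) (trans (cong (P i) O₁.period) e))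
  ... | inj₂ (inj₂ (i , e)) = trans (cong (P N) (sym e)) (trans (pow-comm N i x₂) (trans (cong (P i) O₂-period-N) e))

  pow-N-1-S : ∀ y → P (N ∸ 1) (S y) ≡ y
  pow-N-1-S y = trans (sym (pow-+ (N ∸ 1) 1 y)) (trans (cong (λ k → P k y) (m∸n+n≡m O₁.positive)) (period-N y))

  InOrbit-S : ∀ {b y} → InOrbit σ b y → InOrbit σ b (S y)
  InOrbit-S = InOrbit-pow 1

  InOrbit-S⁻ : ∀ {b y} → InOrbit σ b (S y) → InOrbit σ b y
  InOrbit-S⁻ {b} {y} o = subst (InOrbit σ b) (pow-N-1-S y) (InOrbit-pow (N ∸ 1) o)

  InOrbit-pow⁻ : ∀ {b y} k → InOrbit σ b (P k y) → InOrbit σ b y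
  InOrbit-pow⁻ zero    o = o
  InOrbit-pow⁻ (suc k) o = InOrbit-pow⁻ k (InOrbit-S⁻ o)

  Free-S : ∀ {y} → Free y → Free (S y)
  Free-S (∉O₁ , ∉O₂) = ∉O₁ ∘ InOrbit-S⁻ , ∉O₂ ∘ InOrbit-S⁻

  Free-S⁻ : ∀ {y} → Free (S y) → Free y
  Free-S⁻ (∉O₁ , ∉O₂) = ∉O₁ ∘ InOrbit-S , ∉O₂ ∘ InOrbit-S

  Free-fixed : ∀ {y} → Free y → S y ≡ y
  Free-fixed {y} (∉O₁ , ∉O₂) with covered y
  ... | inj₁ fixed          = Orbit.period y 1 fixed
  ... | inj₂ (inj₁ o)       = ⊥-elim (∉O₁ o)
  ... | inj₂ (inj₂ o)       = ⊥-elim (∉O₂ o)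

  Free-pow : ∀ {y} → Free y → ∀ k → P k y ≡ y
  Free-pow free zero    = refl
  Free-pow free (suc k) = trans (cong S (Free-pow free k)) (Free-fixed free)

  InO₁? : ∀ y → Dec (InO₁ y)
  InO₁? y with O₁.member? y
  ... | inj₁ (i , _ , e) = yes (i , e)
  ... | inj₂ ∉O₁         = no ∉O₁

  InO₂? : ∀ y → Dec (InO₂ y)
  InO₂? y with O₂.member? y
  ... | inj₁ (i , _ , e) = yes (i , e)
  ... | inj₂ ∉O₂         = no ∉O₂

  Free? : ∀ y → Dec (Free y)
  Free? y = ¬? (InO₁? y) ×-dec ¬? (InO₂? y)

  classify : ∀ y → InO₁ y ⊎ InO₂ y ⊎ Free y
  classify y with InO₁? y | InO₂? y
  ... | yes o    | _        = inj₁ o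
  ... | no _     | yes o    = inj₂ (inj₁ o)
  ... | no ∉O₁   | no ∉O₂   = inj₂ (inj₂ (∉O₁ , ∉O₂))

  -- The σ-equivariant projection ρ : O₁ → O₂, σ^i x₁ ↦ σ^i x₂ (well defined
  -- as q ∣ N); it is extended by x₂ outside O₁.
  ρ : Fin m → Fin m
  ρ y with O₁.member? y
  ... | inj₁ (i , _ , _) = P i x₂
  ... | inj₂ _           = x₂

  ρ-spec : ∀ {k y} → P k x₁ ≡ y → ρ y ≡ P k x₂
  ρ-spec {k} {y} e with O₁.member? y
  ... | inj₂ ∉O₁ = ⊥-elim (∉O₁ (k , e))
  ... | inj₁ (i , _ , eᵢ) = begin
    P i x₂        ≡⟨ pow-mod O₂-period-N i ⟩
    P (i % N) x₂  ≡⟨ cong (λ t → P t x₂) same-residue ⟩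
    P (k % N) x₂  ≡⟨ pow-mod O₂-period-N k ⟨
    P k x₂        ∎
    where
    open ≡-Reasoning
    same-residue : i % N ≡ k % N
    same-residue = O₁.exponent-injective (m%n<n i N) (m%n<n k N)
      (trans (sym (pow-mod O₁.period i)) (trans (trans eᵢ (sym e)) (pow-mod O₁.period k)))

  ρ-InO₂ : ∀ y → InO₂ (ρ y)
  ρ-InO₂ y with O₁.member? y
  ... | inj₁ (i , _ , _) = i , refl
  ... | inj₂ _           = 0 , refl

  ρ-S : ∀ {y} → InO₁ y → ρ (S y) ≡ S (ρ y)
  ρ-S {y} (i , e) = trans (ρ-spec {suc i} (cong S e)) (cong S (sym (ρ-spec {i} e)))

  -- Colour 2 is the matching y — ρ y between O₁ and
  -- O₂.
  Matched : Fin m → Fin m → Set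
  Matched y z = (InO₁ y × z ≡ ρ y) ⊎ (InO₁ z × y ≡ ρ z)

  Consecutive : Fin m → Fin m → Set
  Consecutive y z = y <ᶠ z × (∀ w → y <ᶠ w → w <ᶠ z → ¬ Free w)

  LeastFree : Fin m → Set
  LeastFree y = Free y × (∀ w → w <ᶠ y → ¬ Free w)

  Arc : Fin m → Fin m → Set
  Arc y z = (InO₁ y × S y ≡ z) ⊎ (InO₁ y × z ≡ S (ρ y))
          ⊎ (Free y × Free z × Consecutive y z) ⊎ (LeastFree y × InO₁ z)

  Linked : Fin m → Fin m → Set
  Linked y z = Arc y z ⊎ Arc z y

  Matched? : ∀ y z → Dec (Matched y z)
  Matched? y z = (InO₁? y ×-dec (z ≟ᶠ ρ y)) ⊎-dec (InO₁? z ×-dec (y ≟ᶠ ρ z))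

  Consecutive? : ∀ y z → Dec (Consecutive y z)
  Consecutive? y z = (y <ᶠ? z) ×-dec all? (λ w → (y <ᶠ? w) →-dec ((w <ᶠ? z) →-dec ¬? (Free? w)))

  LeastFree? : ∀ y → Dec (LeastFree y)
  LeastFree? y = Free? y ×-dec all? (λ w → (w <ᶠ? y) →-dec ¬? (Free? w))

  Arc? : ∀ y z → Dec (Arc y z)
  Arc? y z = (InO₁? y ×-dec (S y ≟ᶠ z)) ⊎-dec (InO₁? y ×-dec (z ≟ᶠ S (ρ y)))
    ⊎-dec (Free? y ×-dec Free? z ×-dec Consecutive? y z) ⊎-dec (LeastFree? y ×-dec InO₁? z)

  Linked? : ∀ y z → Dec (Linked y z)
  Linked? y z = Arc? y z ⊎-dec Arc? z y

  colour : Bool → Bool → Fin 3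
  colour true  _     = fsuc (fsuc fzero)
  colour false true  = fsuc fzero
  colour false false = fzero

  col₃ : Fin m → Fin m → Fin 3
  col₃ y z = colour (does (Matched? y z)) (does (Linked? y z))

  col₃-symm : ∀ y z → col₃ y z ≡ col₃ z y
  col₃-symm y z = cong₂ colour (does-⇔ (mk⇔ swap swap) (Matched? y z) (Matched? z y))
                               (does-⇔ (mk⇔ swap swap) (Linked? y z) (Linked? z y))

  G₃ : ColoredGraph 3 m
  G₃ = record { col = col₃ ; symm = col₃-symm }

  Matched-S : ∀ {y z} → Matched y z → Matched (S y) (S z)
  Matched-S (inj₁ (o , e)) = inj₁ (InOrbit-S o , trans (cong S e) (sym (ρ-S o)))
  Matched-S (inj₂ (o , e)) = inj₂ (InOrbit-S o , trans (cong S e) (sym (ρ-S o)))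

  Matched-S⁻ : ∀ {y z} → Matched (S y) (S z) → Matched y z
  Matched-S⁻ (inj₁ (o , e)) = inj₁ (InOrbit-S⁻ o , S-injective (trans e (ρ-S (InOrbit-S⁻ o))))
  Matched-S⁻ (inj₂ (o , e)) = inj₂ (InOrbit-S⁻ o , S-injective (trans e (ρ-S (InOrbit-S⁻ o))))

  Arc-S : ∀ {y z} → Arc y z → Arc (S y) (S z)
  Arc-S (inj₁ (o , e)) = inj₁ (InOrbit-S o , cong S e)
  Arc-S (inj₂ (inj₁ (o , e))) = inj₂ (inj₁ (InOrbit-S o , cong S (trans e (sym (ρ-S o)))))
  Arc-S (inj₂ (inj₂ (inj₁ (free-y , free-z , c)))) = inj₂ (inj₂ (inj₁
    (Free-S free-y , Free-S free-z , subst₂ Consecutive (sym (Free-fixed free-y)) (sym (Free-fixed free-z)) c)))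
  Arc-S (inj₂ (inj₂ (inj₂ (least , o)))) = inj₂ (inj₂ (inj₂
    (subst LeastFree (sym (Free-fixed (proj₁ least))) least , InOrbit-S o)))

  Arc-S⁻ : ∀ {y z} → Arc (S y) (S z) → Arc y z
  Arc-S⁻ (inj₁ (o , e)) = inj₁ (InOrbit-S⁻ o , S-injective e)
  Arc-S⁻ (inj₂ (inj₁ (o , e))) = inj₂ (inj₁ (InOrbit-S⁻ o , S-injective (trans e (cong S (ρ-S (InOrbit-S⁻ o))))))
  Arc-S⁻ (inj₂ (inj₂ (inj₁ (free-y , free-z , c)))) = inj₂ (inj₂ (inj₁
    (Free-S⁻ free-y , Free-S⁻ free-z , subst₂ Consecutive (Free-fixed (Free-S⁻ free-y)) (Free-fixed (Free-S⁻ free-z)) c)))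
  Arc-S⁻ (inj₂ (inj₂ (inj₂ (least , o)))) = inj₂ (inj₂ (inj₂
    (subst LeastFree (Free-fixed (Free-S⁻ (proj₁ least))) least , InOrbit-S⁻ o)))

  σ-automorphism : IsAut G₃ σ
  σ-automorphism y z _ = cong₂ colour
    (does-⇔ (mk⇔ Matched-S⁻ Matched-S) (Matched? (S y) (S z)) (Matched? y z))
    (does-⇔ (mk⇔ (map⊎ Arc-S⁻ Arc-S⁻) (map⊎ Arc-S Arc-S)) (Linked? (S y) (S z)) (Linked? y z))

  -- How the three kinds of points sit in G₃: a point of O₁ has exactly one
  -- colour-2 neighbour, a point of O₂ at least two (as N/q ≥ 2), a free point none.
  ρ-image-InO₂ : ∀ {y z} → y ≡ ρ z → InO₂ y
  ρ-image-InO₂ {y} {z} e = subst InO₂ (sym e) (ρ-InO₂ z)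

  Matched-irreflexive : ∀ {y z} → Matched y z → y ≢ z
  Matched-irreflexive (inj₁ (o , e)) refl = disjoint o (ρ-image-InO₂ e)
  Matched-irreflexive (inj₂ (o , e)) refl = disjoint o (ρ-image-InO₂ e)

  unmatched-in-O₁ : ∀ {y z} → InO₁ y → InO₁ z → ¬ Matched y z
  unmatched-in-O₁ _  oz (inj₁ (_ , e)) = disjoint oz (ρ-image-InO₂ e)
  unmatched-in-O₁ oy _  (inj₂ (_ , e)) = disjoint oy (ρ-image-InO₂ e)

  Free-unmatched : ∀ {y z} → Free y → ¬ Matched y z
  Free-unmatched free (inj₁ (o , _)) = proj₁ free o
  Free-unmatched free (inj₂ (_ , e)) = proj₂ free (ρ-image-InO₂ e)

  InO₁-unique-match : ∀ {y z} → InO₁ y → Matched y z → z ≡ ρ y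
  InO₁-unique-match _  (inj₁ (_ , e)) = e
  InO₁-unique-match oy (inj₂ (_ , e)) = ⊥-elim (disjoint oy (ρ-image-InO₂ e))

  TwoMatches : Fin m → Set
  TwoMatches y = Σ (Fin m) λ z → Σ (Fin m) λ z′ → z ≢ z′ × Matched y z × Matched y z′

  O₁-distinct : ∀ i d → 0 < d → d < N → P i x₁ ≢ P (d + i) x₁
  O₁-distinct i d 0<d d<N e = O₁.no-smaller-period d 0<d d<N
    (subst (λ k → P k x₁ ≡ x₁) (m+n∸n≡m d i) (period-from-collision i (d + i) x₁ (m≤n+m i d) e))

  -- σᵏ x₂ is matched with σᵏ x₁; as σ^(q+k) x₂ = σᵏ x₂, it is also matched
  -- with σ^(q+k) x₁ ≠ σᵏ x₁
  matched-O₂ : ∀ k {y} → P k x₂ ≡ y → Matched y (P k x₁)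
  matched-O₂ k e = inj₂ ((k , refl) , trans (sym e) (sym (ρ-spec {k} refl)))

  InO₂-two-matches : ∀ {y} → InO₂ y → TwoMatches y
  InO₂-two-matches (j , e) =
    P j x₁ , P (q + j) x₁ , O₁-distinct j q (≤-trans (s≤s z≤n) 3≤q) q<N ,
    matched-O₂ j e , matched-O₂ (q + j) (trans q-shift e)
    where
    q-shift : P (q + j) x₂ ≡ P j x₂
    q-shift = trans (pow-+ q j x₂) (trans (pow-comm q j x₂) (cong (P j) O₂.period))

  InO₂-matched : ∀ {y} → InO₂ y → ∃ (Matched y)
  InO₂-matched o with InO₂-two-matches o
  ... | z , _ , _ , mt , _ = z , mt

  InO₁-not-two-matches : ∀ {y} → InO₁ y → ¬ TwoMatches y
  InO₁-not-two-matches o (z , z′ , z≢z′ , m , m′) =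
    z≢z′ (trans (InO₁-unique-match o m) (sym (InO₁-unique-match o m′)))

  Arc-within-O₁ : ∀ {y z} → InO₁ y → InO₁ z → Arc y z → S y ≡ z
  Arc-within-O₁ _  _  (inj₁ (_ , e)) = e
  Arc-within-O₁ _  oz (inj₂ (inj₁ (_ , e))) = ⊥-elim (disjoint oz (subst InO₂ (sym e) (InOrbit-S (ρ-InO₂ _))))
  Arc-within-O₁ oy _  (inj₂ (inj₂ (inj₁ (free-y , _)))) = ⊥-elim (proj₁ free-y oy)
  Arc-within-O₁ oy _  (inj₂ (inj₂ (inj₂ ((free-y , _) , _)))) = ⊥-elim (proj₁ free-y oy)

  Linked-within-O₁ : ∀ {y z} → InO₁ y → InO₁ z → Linked y z → S y ≡ z ⊎ S z ≡ y
  Linked-within-O₁ oy oz = map⊎ (Arc-within-O₁ oy oz) (Arc-within-O₁ oz oy)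

  Arc-from-O₂ : ∀ {y z} → InO₂ y → ¬ Arc y z
  Arc-from-O₂ o (inj₁ (o₁ , _))                 = disjoint o₁ o
  Arc-from-O₂ o (inj₂ (inj₁ (o₁ , _)))          = disjoint o₁ o
  Arc-from-O₂ o (inj₂ (inj₂ (inj₁ (free , _)))) = proj₂ free o
  Arc-from-O₂ o (inj₂ (inj₂ (inj₂ (least , _)))) = proj₂ (proj₁ least) o

  -- σ x₁ is joined to x₂ by neither colour 1 nor 2 (this needs q ≥ 3); this
  -- is what distinguishes the direction σ from σ⁻¹ along O₁.
  σx₁-unmatched-x₂ : ¬ Matched (S x₁) x₂
  σx₁-unmatched-x₂ (inj₁ (_ , e)) = O₂.no-smaller-period 1 (s≤s z≤n) (≤-trans (s≤s (s≤s z≤n)) 3≤q)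
    (sym (trans e (ρ-spec {1} refl)))
  σx₁-unmatched-x₂ (inj₂ (o , _)) = disjoint o (0 , refl)

  σx₁-unlinked-x₂ : ¬ Linked (S x₁) x₂
  σx₁-unlinked-x₂ (inj₁ (inj₁ (_ , e))) = disjoint (2 , e) (0 , refl)
  σx₁-unlinked-x₂ (inj₁ (inj₂ (inj₁ (_ , e)))) = O₂.no-smaller-period 2 (s≤s z≤n) 3≤q
    (sym (trans e (cong S (ρ-spec {1} refl))))
  σx₁-unlinked-x₂ (inj₁ (inj₂ (inj₂ (inj₁ (free , _))))) = proj₁ free (1 , refl)
  σx₁-unlinked-x₂ (inj₁ (inj₂ (inj₂ (inj₂ (least , _))))) = proj₁ (proj₁ least) (1 , refl)
  σx₁-unlinked-x₂ (inj₂ arc) = Arc-from-O₂ (0 , refl) arc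

  Arc-between-free : ∀ {y z} → Free y → Free z → Arc y z → Consecutive y z
  Arc-between-free free-y _ (inj₁ (o , _))        = ⊥-elim (proj₁ free-y o)
  Arc-between-free free-y _ (inj₂ (inj₁ (o , _))) = ⊥-elim (proj₁ free-y o)
  Arc-between-free _ _ (inj₂ (inj₂ (inj₁ (_ , _ , c)))) = c
  Arc-between-free _ free-z (inj₂ (inj₂ (inj₂ (_ , o)))) = ⊥-elim (proj₁ free-z o)

  Linked-between-free : ∀ {y z} → Free y → Free z → Linked y z → Consecutive y z ⊎ Consecutive z y
  Linked-between-free free-y free-z = map⊎ (Arc-between-free free-y free-z) (Arc-between-free free-z free-y)

  x₁-not-free : ¬ Free x₁
  x₁-not-free free = proj₁ free (0 , refl)

  Linked-free-x₁ : ∀ {v} → Free v → Linked v x₁ → LeastFree v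
  Linked-free-x₁ free (inj₁ (inj₁ (o , _)))        = ⊥-elim (proj₁ free o)
  Linked-free-x₁ free (inj₁ (inj₂ (inj₁ (o , _)))) = ⊥-elim (proj₁ free o)
  Linked-free-x₁ _ (inj₁ (inj₂ (inj₂ (inj₁ (_ , free-x₁ , _))))) = ⊥-elim (x₁-not-free free-x₁)
  Linked-free-x₁ _ (inj₁ (inj₂ (inj₂ (inj₂ (least , _))))) = least
  Linked-free-x₁ free (inj₂ (inj₁ (_ , e)))        = ⊥-elim (proj₁ free (1 , e))
  Linked-free-x₁ free (inj₂ (inj₂ (inj₁ (_ , e)))) = ⊥-elim (proj₂ free (subst InO₂ (sym e) (InOrbit-S (ρ-InO₂ x₁))))
  Linked-free-x₁ _ (inj₂ (inj₂ (inj₂ (inj₁ (free-x₁ , _))))) = ⊥-elim (x₁-not-free free-x₁)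
  Linked-free-x₁ _ (inj₂ (inj₂ (inj₂ (inj₂ (least , _))))) = ⊥-elim (x₁-not-free (proj₁ least))

  colour-matched : ∀ {a b c d} → colour a b ≡ colour c d → a ≡ c
  colour-matched {true}  {_}     {true}  e = refl
  colour-matched {false} {_}     {false} e = refl
  colour-matched {true}  {_}     {false} {true}  ()
  colour-matched {true}  {_}     {false} {false} ()
  colour-matched {false} {true}  {true}  ()
  colour-matched {false} {false} {true}  ()

  colour-linked : ∀ {b d} → colour false b ≡ colour false d → b ≡ d
  colour-linked {true}  {true}  _ = refl
  colour-linked {false} {false} _ = refl
  colour-linked {true}  {false} ()
  colour-linked {false} {true}  ()

  module Automorphism (π : Permutation′ m) (aut : IsAut G₃ π) where

    f : Fin m → Fin m
    f y = π ⟨$⟩ʳ y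

    f-injective : ∀ {y z} → f y ≡ f z → y ≡ z
    f-injective = permutation-injective π

    same-matched : ∀ {y z} → y ≢ z → does (Matched? (f y) (f z)) ≡ does (Matched? y z)
    same-matched {y} {z} y≢z = colour-matched (aut y z y≢z)

    Matched-f : ∀ {y z} → Matched y z → Matched (f y) (f z)
    Matched-f {y} {z} mt = transport-does (Matched? y z) (Matched? (f y) (f z))
      (sym (same-matched (Matched-irreflexive mt))) mt

    Matched-f⁻ : ∀ {y z} → Matched (f y) (f z) → Matched y z
    Matched-f⁻ {y} {z} mt = transport-does (Matched? (f y) (f z)) (Matched? y z)
      (same-matched (λ { refl → Matched-irreflexive mt refl })) mt

    Matched-f⁻′ : ∀ {y w} → Matched (f y) w → Matched y (π ⟨$⟩ˡ w)
    Matched-f⁻′ {y} {w} mt = Matched-f⁻ (subst (Matched (f y)) (sym (inverseʳ π)) mt)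

    same-linked : ∀ {y z} → y ≢ z → ¬ Matched y z → does (Linked? (f y) (f z)) ≡ does (Linked? y z)
    same-linked {y} {z} y≢z ¬mt = colour-linked
      (subst₂ (λ a b → colour a (does (Linked? (f y) (f z))) ≡ colour b (does (Linked? y z)))
              (trans (same-matched y≢z) unmatched) unmatched (aut y z y≢z))
      where
      unmatched : does (Matched? y z) ≡ false
      unmatched = dec-false (Matched? y z) ¬mt

    Linked-f : ∀ {y z} → y ≢ z → ¬ Matched y z → Linked y z → Linked (f y) (f z)
    Linked-f {y} {z} y≢z ¬mt = transport-does (Linked? y z) (Linked? (f y) (f z)) (sym (same-linked y≢z ¬mt))

    Linked-f⁻ : ∀ {y z} → y ≢ z → ¬ Matched y z → Linked (f y) (f z) → Linked y z
    Linked-f⁻ {y} {z} y≢z ¬mt = transport-does (Linked? (f y) (f z)) (Linked? y z) (same-linked y≢z ¬mt)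

    TwoMatches-f⁻ : ∀ {y} → TwoMatches (f y) → TwoMatches y
    TwoMatches-f⁻ (w , w′ , w≢w′ , mt , mt′) =
      π ⟨$⟩ˡ w , π ⟨$⟩ˡ w′ , (w≢w′ ∘ permutation-injective (flip π)) ,
      Matched-f⁻′ mt , Matched-f⁻′ mt′

    f-InO₁ : ∀ {y} → InO₁ y → InO₁ (f y)
    f-InO₁ {y} o with classify (f y)
    ... | inj₁ o′          = o′
    ... | inj₂ (inj₁ o₂)   = ⊥-elim (InO₁-not-two-matches o (TwoMatches-f⁻ (InO₂-two-matches o₂)))
    ... | inj₂ (inj₂ free) = ⊥-elim (Free-unmatched free (Matched-f {y} {ρ y} (inj₁ (o , refl))))

    f-Free : ∀ {y} → Free y → Free (f y)
    f-Free free = (λ o → Free-unmatched free (Matched-f⁻′ {w = ρ _} (inj₁ (o , refl))))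
                , (λ o → Free-unmatched free (Matched-f⁻′ (proj₂ (InO₂-matched o))))

    f-ρ : ∀ {y} → InO₁ y → f (ρ y) ≡ ρ (f y)
    f-ρ o = InO₁-unique-match (f-InO₁ o) (Matched-f (inj₁ (o , refl)))

    module Fixing (f-x₁ : f x₁ ≡ x₁) where

      f-x₂ : f x₂ ≡ x₂
      f-x₂ = begin
        f x₂        ≡⟨ cong f (ρ-spec {0} refl) ⟨
        f (ρ x₁)    ≡⟨ f-ρ (0 , refl) ⟩
        ρ (f x₁)    ≡⟨ cong ρ f-x₁ ⟩
        ρ x₁        ≡⟨ ρ-spec {0} refl ⟩
        x₂          ∎
        where open ≡-Reasoning

      -- f fixes σ x₁: otherwise f (σ x₁) = σ⁻¹ x₁, which is joined to x₂ by colour 1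
      f-σx₁ : f (S x₁) ≡ S x₁
      f-σx₁ with Linked-within-O₁ (0 , refl) (f-InO₁ (1 , refl))
                   (subst (λ t → Linked t (f (S x₁))) f-x₁
                     (Linked-f (O₁-distinct 0 1 (s≤s z≤n) 1<N)
                               (unmatched-in-O₁ (0 , refl) (1 , refl)) (inj₁ (inj₁ ((0 , refl) , refl)))))
      ... | inj₁ e = sym e
      ... | inj₂ e = ⊥-elim (σx₁-unlinked-x₂ (Linked-f⁻ (λ eq → disjoint (1 , eq) (0 , refl)) σx₁-unmatched-x₂
                       (subst (Linked (f (S x₁))) (sym f-x₂) (inj₁ (inj₂ (inj₁ (o , x₂-after)))))))
        where
        o : InO₁ (f (S x₁))
        o = f-InO₁ (1 , refl)
        x₂-after : x₂ ≡ S (ρ (f (S x₁)))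
        x₂-after = begin
          x₂                   ≡⟨ ρ-spec {0} refl ⟨
          ρ x₁                 ≡⟨ cong ρ e ⟨
          ρ (S (f (S x₁)))     ≡⟨ ρ-S o ⟩
          S (ρ (f (S x₁)))     ∎
          where open ≡-Reasoning

      -- if f fixes σⁱ x₁ and σⁱ⁺¹ x₁ it fixes σⁱ⁺² x₁, the only σ-neighbour of
      -- σⁱ⁺¹ x₁ other than σⁱ x₁
      f-step : ∀ i → f (P i x₁) ≡ P i x₁ → f (P (suc i) x₁) ≡ P (suc i) x₁ →
               f (P (suc (suc i)) x₁) ≡ P (suc (suc i)) x₁
      f-step i fix₀ fix₁ with Linked-within-O₁ (suc i , refl) (f-InO₁ (suc (suc i) , refl)) link
        where
        link : Linked (P (suc i) x₁) (f (P (suc (suc i)) x₁))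
        link = subst (λ t → Linked t (f (P (suc (suc i)) x₁))) fix₁
          (Linked-f (O₁-distinct (suc i) 1 (s≤s z≤n) 1<N)
                    (unmatched-in-O₁ (suc i , refl) (suc (suc i) , refl)) (inj₁ (inj₁ ((suc i , refl) , refl))))
      ... | inj₁ e = sym e
      ... | inj₂ e = ⊥-elim (O₁-distinct i 2 (s≤s z≤n) 2<N (sym (f-injective (trans (S-injective e) (sym fix₀)))))

      f-fixes-pair : ∀ i → f (P i x₁) ≡ P i x₁ × f (P (suc i) x₁) ≡ P (suc i) x₁
      f-fixes-pair zero    = f-x₁ , f-σx₁
      f-fixes-pair (suc i) with f-fixes-pair i
      ... | fix₀ , fix₁ = fix₁ , f-step i fix₀ fix₁

      f-fixes-O₁ : ∀ {y} → InO₁ y → f y ≡ y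
      f-fixes-O₁ (i , refl) = proj₁ (f-fixes-pair i)

      f-fixes-O₂ : ∀ {y} → InO₂ y → f y ≡ y
      f-fixes-O₂ (j , refl) = begin
        f (P j x₂)        ≡⟨ cong f (ρ-spec {j} refl) ⟨
        f (ρ (P j x₁))    ≡⟨ f-ρ (j , refl) ⟩
        ρ (f (P j x₁))    ≡⟨ cong ρ (f-fixes-O₁ (j , refl)) ⟩
        ρ (P j x₁)        ≡⟨ ρ-spec {j} refl ⟩
        P j x₂            ∎
        where open ≡-Reasoning

      -- A free point u all of whose smaller free points are fixed is not moved
      -- up by f: f u would be joined by colour 1 to x₁ (if u is the least free
      -- point) or to the free point just below u.
      not-moved-up : ∀ {u} → Free u → (∀ w → w <ᶠ u → Free w → f w ≡ w) → ¬ (u <ᶠ f u)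
      not-moved-up {u} free fixed-below u<fu with any? (λ w → (w <ᶠ? u) ×-dec Free? w)
      ... | no none = proj₂ (Linked-free-x₁ (f-Free free) link) u u<fu free
        where
        link : Linked (f u) x₁
        link = subst (Linked (f u)) f-x₁
          (Linked-f (λ { refl → x₁-not-free free }) (Free-unmatched free)
            (inj₁ (inj₂ (inj₂ (inj₂ ((free , λ w w<u free-w → none (w , w<u , free-w)) , (0 , refl)))))))
      ... | yes below with greatest-below Free? (toℕ u) below
      ...   | w , w<u , free-w , none-between with Linked-between-free free-w (f-Free free) link
        where
        link : Linked w (f u)
        link = subst (λ t → Linked t (f u)) (fixed-below w w<u free-w)
          (Linked-f (λ { refl → <-irrefl refl w<u }) (Free-unmatched free-w)
            (inj₁ (inj₂ (inj₂ (inj₁ (free-w , free , w<u , none-between))))))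
      ...     | inj₁ (_ , nothing-between) = nothing-between u w<u u<fu free
      ...     | inj₂ (fu<w , _)            = <-asym u<fu (<-trans fu<w w<u)

      f-fixes-free : ∀ k {u} → toℕ u < k → Free u → f u ≡ u
      f-fixes-free zero ()
      f-fixes-free (suc k) {u} u<1+k free with <-cmp (toℕ (f u)) (toℕ u)
      ... | tri≈ _ e _    = toℕ-injective e
      ... | tri< fu<u _ _ = ⊥-elim (<-irrefl (cong toℕ (f-injective (f-fixes-free k (≤-trans fu<u u≤k) (f-Free free)))) fu<u)
        where
        u≤k : toℕ u ≤ k
        u≤k = s≤s⁻¹ u<1+k
      ... | tri> _ _ u<fu = ⊥-elim (not-moved-up free (λ w w<u → f-fixes-free k (≤-trans w<u (s≤s⁻¹ u<1+k))) u<fu)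

      f-identity : ∀ y → f y ≡ y
      f-identity y with classify y
      ... | inj₁ o               = f-fixes-O₁ o
      ... | inj₂ (inj₁ o)        = f-fixes-O₂ o
      ... | inj₂ (inj₂ free)     = f-fixes-free (suc (toℕ y)) ≤-refl free

  -- Aut(G₃) = ⟨σ⟩: an automorphism π sends x₁ to some σᵏ x₁, so σ^(N−k) ∘ π
  -- fixes x₁, hence is the identity, and π = σᵏ.
  automorphism-in-cyclic : ∀ π → IsAut G₃ π → InCyclic σ π
  automorphism-in-cyclic π aut with O₁.member? (π ⟨$⟩ʳ x₁)
  ... | inj₂ ∉O₁ = ⊥-elim (∉O₁ (Automorphism.f-InO₁ π aut (0 , refl)))
  ... | inj₁ (k , k<N , e) = k , λ y → begin
      π ⟨$⟩ʳ y                     ≡⟨ period-N (π ⟨$⟩ʳ y) ⟨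
      P N (π ⟨$⟩ʳ y)               ≡⟨ cong (λ t → P t (π ⟨$⟩ʳ y)) (m+[n∸m]≡n (<⇒≤ k<N)) ⟨
      P (k + (N ∸ k)) (π ⟨$⟩ʳ y)   ≡⟨ pow-+ k (N ∸ k) (π ⟨$⟩ʳ y) ⟩
      P k (P (N ∸ k) (π ⟨$⟩ʳ y))   ≡⟨ cong (P k) (powₚ-apply (N ∸ k) (π ⟨$⟩ʳ y)) ⟨
      P k (ψ ⟨$⟩ʳ y)               ≡⟨ cong (P k) (Automorphism.Fixing.f-identity ψ ψ-aut ψ-x₁ y) ⟩
      P k y                        ∎
    where
    open ≡-Reasoning
    ψ : Permutation′ m
    ψ = π ∘ₚ powₚ (N ∸ k)
    ψ-aut : IsAut G₃ ψ
    ψ-aut = ∘-automorphism G₃ π (powₚ (N ∸ k)) aut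
      (cyclic-automorphisms G₃ σ σ-automorphism (powₚ (N ∸ k)) (N ∸ k , powₚ-apply (N ∸ k)))
    ψ-x₁ : ψ ⟨$⟩ʳ x₁ ≡ x₁
    ψ-x₁ = begin
      ψ ⟨$⟩ʳ x₁               ≡⟨ powₚ-apply (N ∸ k) (π ⟨$⟩ʳ x₁) ⟩
      P (N ∸ k) (π ⟨$⟩ʳ x₁)   ≡⟨ cong (P (N ∸ k)) e ⟨
      P (N ∸ k) (P k x₁)      ≡⟨ pow-+ (N ∸ k) k x₁ ⟨
      P (N ∸ k + k) x₁        ≡⟨ cong (λ t → P t x₁) (m∸n+n≡m (<⇒≤ k<N)) ⟩
      P N x₁                  ≡⟨ O₁.period ⟩
      x₁                      ∎

  in-GR3 : CyclicInGR 3 σ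
  in-GR3 = G₃ , λ π → mk⇔ (cyclic-automorphisms G₃ σ σ-automorphism π) (automorphism-in-cyclic π)

  -- No σ-invariant 2-coloured graph G has Aut(G) = ⟨σ⟩ when q ∈ {3, 4, 5}:
  -- the colours between x₁ and O₂ form a 2-colouring of ℤ/q, which has a
  -- mirror symmetry; reflecting O₁ about x₁ and O₂ about the mirror centre
  -- (fixing the free points) gives an automorphism of G outside ⟨σ⟩.
  module NoTwoColouring (q∈345 : q ≡ 3 ⊎ q ≡ 4 ⊎ q ≡ 5) (G : ColoredGraph 2 m) (σ-aut : IsAut G σ) where

    c : Fin m → Fin m → Fin 2
    c = col G

    col-pow : ∀ k {y z} → y ≢ z → c (P k y) (P k z) ≡ c y z
    col-pow k {y} {z} = pow-preserves G σ σ-aut k y z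

    mirror : Mirrored q (λ t → c x₁ (P t x₂))
    mirror = periodic-mirrored q q∈345 (λ t → c x₁ (P t x₂)) (λ t → cong (c x₁) (pow-mod O₂.period t))

    centre : ℕ
    centre = proj₁ mirror

    module R₁ = O₁.Reflection 0
    module R₂ = O₂.Reflection centre

    R₂-mirror : ∀ {z} → InO₂ z → c x₁ (R₂.reflect z) ≡ c x₁ z
    R₂-mirror {z} (j , eⱼ) = begin
      c x₁ (R₂.reflect z)              ≡⟨ cong (c x₁) reflected ⟩
      c x₁ (P (centre + q ∸ i) x₂)     ≡⟨ proj₂ mirror i<q ⟩
      c x₁ (P i x₂)                    ≡⟨ cong (c x₁) e ⟩
      c x₁ z                           ∎
      where
      open ≡-Reasoning
      i : ℕ
      i = j % q
      i<q : i < q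
      i<q = m%n<n j q
      e : P i x₂ ≡ z
      e = trans (sym (pow-mod O₂.period j)) eⱼ
      reflected : R₂.reflect z ≡ P (centre + q ∸ i) x₂
      reflected = pow-injective i (begin
        P i (R₂.reflect z)                ≡⟨ R₂.reflect-spec {i} e ⟩
        P centre x₂                       ≡⟨ cong (P centre) O₂.period ⟨
        P centre (P q x₂)                 ≡⟨ pow-+ centre q x₂ ⟨
        P (centre + q) x₂                 ≡⟨ cong (λ t → P t x₂) (m+[n∸m]≡n (≤-trans (<⇒≤ i<q) (m≤n+m q centre))) ⟨
        P (i + (centre + q ∸ i)) x₂       ≡⟨ pow-+ i (centre + q ∸ i) x₂ ⟩
        P i (P (centre + q ∸ i) x₂)       ∎)

    r : Fin m → Fin m
    r y = R₁.reflect (R₂.reflect y)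

    r-O₁ : ∀ {y} → InO₁ y → r y ≡ R₁.reflect y
    r-O₁ o = cong R₁.reflect (R₂.reflect-outside (disjoint o))

    r-O₂ : ∀ {y} → InO₂ y → r y ≡ R₂.reflect y
    r-O₂ o = R₁.reflect-outside (λ o₁ → disjoint o₁ (R₂.reflect-InOrbit o))

    r-free : ∀ {y} → Free y → r y ≡ y
    r-free (∉O₁ , ∉O₂) = trans (cong R₁.reflect (R₂.reflect-outside ∉O₂)) (R₁.reflect-outside ∉O₁)

    r-InO₁ : ∀ {y} → InO₁ y → InO₁ (r y)
    r-InO₁ o = subst InO₁ (sym (r-O₁ o)) (R₁.reflect-InOrbit o)

    r-InO₂ : ∀ {y} → InO₂ y → InO₂ (r y)
    r-InO₂ o = subst InO₂ (sym (r-O₂ o)) (R₂.reflect-InOrbit o)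

    r-involutive : ∀ y → r (r y) ≡ y
    r-involutive y with classify y
    ... | inj₁ o          = trans (r-O₁ (r-InO₁ o)) (trans (cong R₁.reflect (r-O₁ o)) (R₁.reflect-involutive o))
    ... | inj₂ (inj₁ o)   = trans (r-O₂ (r-InO₂ o)) (trans (cong R₂.reflect (r-O₂ o)) (R₂.reflect-involutive o))
    ... | inj₂ (inj₂ fr)  = trans (cong r (r-free fr)) (r-free fr)

    r-injective : ∀ {y z} → y ≢ z → r y ≢ r z
    r-injective {y} {z} y≢z e = y≢z (trans (sym (r-involutive y)) (trans (cong r e) (r-involutive z)))

    rₚ : Permutation′ m
    rₚ = permutation r r r-involutive r-involutive

    moved-back : ∀ n {y z y′ z′} → y ≢ z → P n (r y) ≡ y′ → P n (r z) ≡ z′ → c (r y) (r z) ≡ c y′ z′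
    moved-back n y≢z e e′ = trans (sym (col-pow n (r-injective y≢z))) (cong₂ c e e′)

    r-O₁-O₁ : ∀ {y z} → y ≢ z → InO₁ y → InO₁ z → c (r y) (r z) ≡ c y z
    r-O₁-O₁ {y} {z} y≢z (i , eᵢ) (j , eⱼ) with R₁.reflect-pair i j eᵢ eⱼ
    ... | to-z , to-y = trans (moved-back (i + j) y≢z
            (trans (cong (P (i + j)) (r-O₁ (i , eᵢ))) to-z) (trans (cong (P (i + j)) (r-O₁ (j , eⱼ))) to-y))
          (symm G z y)

    r-O₂-O₂ : ∀ {y z} → y ≢ z → InO₂ y → InO₂ z → c (r y) (r z) ≡ c y z
    r-O₂-O₂ {y} {z} y≢z (i , eᵢ) (j , eⱼ) with R₂.reflect-pair i j eᵢ eⱼ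
    ... | to-z , to-y = trans (moved-back (i + j) y≢z
            (trans (cong (P (i + j)) (r-O₂ (i , eᵢ))) to-z) (trans (cong (P (i + j)) (r-O₂ (j , eⱼ))) to-y))
          (trans (col-pow centre (y≢z ∘ sym)) (symm G z y))

    r-O₁-O₂ : ∀ {y z} → InO₁ y → InO₂ z → c (r y) (r z) ≡ c y z
    r-O₁-O₂ {y} {z} (i , eᵢ) o₂ = begin
      c (r y) (r z)                          ≡⟨ col-pow i (r-injective y≢z) ⟨
      c (P i (r y)) (P i (r z))              ≡⟨ cong₂ c (trans (cong (P i) (r-O₁ (i , eᵢ))) (R₁.reflect-spec {i} eᵢ))
                                                        (cong (P i) (r-O₂ o₂)) ⟩
      c x₁ (P i (R₂.reflect z))              ≡⟨ cong (λ t → c x₁ (P i (R₂.reflect t))) z′-moved ⟨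
      c x₁ (P i (R₂.reflect (P i z′)))       ≡⟨ cong (c x₁) (R₂.reflect-reverses i o₂′) ⟩
      c x₁ (R₂.reflect z′)                   ≡⟨ R₂-mirror o₂′ ⟩
      c x₁ z′                                ≡⟨ col-pow i (λ e → disjoint (0 , refl) (subst InO₂ (sym e) o₂′)) ⟨
      c (P i x₁) (P i z′)                    ≡⟨ cong₂ c eᵢ z′-moved ⟩
      c y z                                  ∎
      where
      open ≡-Reasoning
      y≢z : y ≢ z
      y≢z e = disjoint (i , eᵢ) (subst InO₂ (sym e) o₂)
      z′ : Fin m
      z′ = powₚ i ⟨$⟩ˡ z
      z′-moved : P i z′ ≡ z
      z′-moved = trans (sym (powₚ-apply i z′)) (inverseʳ (powₚ i))
      o₂′ : InO₂ z′
      o₂′ = InOrbit-pow⁻ i (subst InO₂ (sym z′-moved) o₂)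

    colour-to-free : ∀ {b w z} → ¬ Free b → InOrbit σ b w → Free z → c w z ≡ c b z
    colour-to-free {b} {w} {z} b-not-free (a , e) free =
      trans (cong₂ c (sym e) (sym (Free-pow free a))) (col-pow a (λ b≡z → b-not-free (subst Free (sym b≡z) free)))

    r-orbit-free : ∀ {b y z} → ¬ Free b → InOrbit σ b y → InOrbit σ b (r y) → Free z → c (r y) (r z) ≡ c y z
    r-orbit-free b-not-free o o′ free = trans (cong (c _) (r-free free))
      (trans (colour-to-free b-not-free o′ free) (sym (colour-to-free b-not-free o free)))

    x₂-not-free : ¬ Free x₂
    x₂-not-free free = proj₂ free (0 , refl)

    r-automorphism : IsAut G rₚ
    r-automorphism y z y≢z with classify y | classify z
    ... | inj₁ oy         | inj₁ oz         = r-O₁-O₁ y≢z oy oz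
    ... | inj₂ (inj₁ oy)  | inj₂ (inj₁ oz)  = r-O₂-O₂ y≢z oy oz
    ... | inj₁ oy         | inj₂ (inj₁ oz)  = r-O₁-O₂ oy oz
    ... | inj₂ (inj₁ oy)  | inj₁ oz         = trans (symm G (r y) (r z)) (trans (r-O₁-O₂ oz oy) (symm G z y))
    ... | inj₁ oy         | inj₂ (inj₂ fz)  = r-orbit-free x₁-not-free oy (r-InO₁ oy) fz
    ... | inj₂ (inj₁ oy)  | inj₂ (inj₂ fz)  = r-orbit-free x₂-not-free oy (r-InO₂ oy) fz
    ... | inj₂ (inj₂ fy)  | inj₁ oz         = trans (symm G (r y) (r z))
            (trans (r-orbit-free x₁-not-free oz (r-InO₁ oz) fy) (symm G z y))
    ... | inj₂ (inj₂ fy)  | inj₂ (inj₁ oz)  = trans (symm G (r y) (r z))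
            (trans (r-orbit-free x₂-not-free oz (r-InO₂ oz) fy) (symm G z y))
    ... | inj₂ (inj₂ fy)  | inj₂ (inj₂ fz)  = cong₂ c (r-free fy) (r-free fz)

    -- r fixes x₁ but maps σ x₁ to σ⁻¹ x₁ ≠ σ x₁, so it is no power of σ
    r-not-cyclic : ¬ InCyclic σ rₚ
    r-not-cyclic (k , r≈σᵏ) = O₁.no-smaller-period 2 (s≤s z≤n) 2<N (trans (cong S σx₁-fixed) (R₁.reflect-spec {1} refl))
      where
      x₁-fixed : P k x₁ ≡ x₁
      x₁-fixed = trans (sym (r≈σᵏ x₁)) (trans (r-O₁ (0 , refl)) (R₁.reflect-spec {0} refl))
      σx₁-fixed : S x₁ ≡ R₁.reflect (S x₁)
      σx₁-fixed = sym (trans (sym (r-O₁ (1 , refl))) (trans (r≈σᵏ (S x₁)) (trans (pow-comm k 1 x₁) (cong S x₁-fixed))))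

  not-in-GR2 : q ≡ 3 ⊎ q ≡ 4 ⊎ q ≡ 5 → ¬ CyclicInGR 2 σ
  not-in-GR2 q∈345 (G , aut⇔cyclic) = r-not-cyclic (Equivalence.from (aut⇔cyclic rₚ) r-automorphism)
    where
    σ-aut : IsAut G σ
    σ-aut = Equivalence.to (aut⇔cyclic σ) (1 , λ _ → refl)
    open NoTwoColouring q∈345 G σ-aut using (rₚ; r-automorphism; r-not-cyclic)

np-small : ∀ {p} → p ≡ 2 ⊎ p ≡ 3 ⊎ p ≡ 5 → np p ≡ 3 ⊎ np p ≡ 4 ⊎ np p ≡ 5
np-small (inj₁ refl)        = inj₂ (inj₁ refl)
np-small (inj₂ (inj₁ refl)) = inj₁ refl
np-small (inj₂ (inj₂ refl)) = inj₂ (inj₂ refl)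

np-bounds : ∀ {q} → q ≡ 3 ⊎ q ≡ 4 ⊎ q ≡ 5 → 3 ≤ q × q ≤ 5
np-bounds (inj₁ refl)        = s≤s (s≤s (s≤s z≤n)) , s≤s (s≤s (s≤s z≤n))
np-bounds (inj₂ (inj₁ refl)) = s≤s (s≤s (s≤s z≤n)) , s≤s (s≤s (s≤s (s≤s z≤n)))
np-bounds (inj₂ (inj₂ refl)) = s≤s (s≤s (s≤s z≤n)) , ≤-refl

np-divides : ∀ {p n} → p ≡ 2 ⊎ p ≡ 3 ⊎ p ≡ 5 → n ≥ 2 → np p ∣ p ^ n
np-divides {n = suc (suc k)} (inj₁ refl)        (s≤s (s≤s _)) = subst (4 ∣_) (*-assoc 2 2 (2 ^ k)) (m∣m*n (2 ^ k))
np-divides {n = suc (suc k)} (inj₂ (inj₁ refl)) (s≤s (s≤s _)) = m∣m*n (3 ^ suc k)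
np-divides {n = suc (suc k)} (inj₂ (inj₂ refl)) (s≤s (s≤s _)) = m∣m*n (5 ^ suc k)

lemma4p3 : (p n : ℕ) → (p ≡ 2 ⊎ p ≡ 3 ⊎ p ≡ 5) → n ≥ 2 → p ^ n > 5 →
    (m : ℕ) (σ : Permutation′ m) →
    CyclicOrder σ (p ^ n) →
    (x₁ x₂ : Fin m) →
    OrbitCard σ x₁ (p ^ n) →
    OrbitCard σ x₂ (np p) →
    (∀ y → OrbitCard σ y 1 ⊎ InOrbit σ x₁ y ⊎ InOrbit σ x₂ y) →
    CyclicInGR* 3 σ
lemma4p3 p n p∈235 n≥2 pⁿ>5 m σ _ x₁ x₂ card₁ card₂ covered =
  TwoOrbits.in-GR3 σ x₁ x₂ (p ^ n) (np p) card₁ card₂ np∣pⁿ np<pⁿ 3≤np covered ,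
  TwoOrbits.not-in-GR2 σ x₁ x₂ (p ^ n) (np p) card₁ card₂ np∣pⁿ np<pⁿ 3≤np covered np∈345
  where
  np∈345 : np p ≡ 3 ⊎ np p ≡ 4 ⊎ np p ≡ 5
  np∈345 = np-small p∈235
  3≤np : 3 ≤ np p
  3≤np = proj₁ (np-bounds np∈345)
  np<pⁿ : np p < p ^ n
  np<pⁿ = ≤-<-trans (proj₂ (np-bounds np∈345)) pⁿ>5
  np∣pⁿ : np p ∣ p ^ n
  np∣pⁿ = np-divides p∈235 n≥2
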